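{- Let $n,r,t$ be positive integers and let $G=K_{n,\ldots,n,(tr+1)n}$ be the complete $(r+1)$-partite graph with $r$ parts of size $n$ and one part of size $(tr+1)n$. Then $\mathrm{def}(G)=0$ if and only if $n(r+1)$ is even.
   Context: A complete $(r+1)$-partite graph has its vertex set partitioned into $r+1$ nonempty independent sets with every two vertices in different parts adjacent. For a proper edge-coloring $\alpha$ of a graph $G$ (with positive integer colors) and a vertex $v$, let $S(v,\alpha)$ be the set of colors on edges incident to $v$, and $\mathrm{def}(v,\alpha)=\max S(v,\alpha)-\min S(v,\alpha)-|S(v,\alpha)|+1$. The deficiency of $G$ is $\mathrm{def}(G)=\min_\alpha \sum_{v\in V(G)}\mathrm{def}(v,\alpha)$ over all proper edge-colorings $\alpha$ of $G$; equivalently, the minimum number of pendant edges whose attachment to $G$ yields a graph admitting an interval coloring (a proper edge-coloring with colors $1,\ldots,t$, all used, in which every vertex's color set is an integer interval). In particular $\mathrm{def}(G)=0$ iff $G$ has an interval coloring. -}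

module Defs where

open import Data.Nat using (ℕ; zero; suc; _+_; _*_; _∸_; _≤_; _⊔_; _⊓_; _≡ᵇ_)
import Data.Nat as ℕ
open import Data.Bool using (Bool; true; false; not)
open import Data.Fin using (Fin; splitAt)
open import Data.Sum using (inj₁; inj₂)
open import Data.List using (List; []; _∷_; map; filterᵇ; allFin; length; deduplicate; replicate; _++_; foldr)
open import Data.Nat.ListAction using (sum)
open import Data.Product using (Σ; _×_; _,_)
open import Relation.Binary.PropositionalEquality using (_≡_; _≢_)

-- A (simple) graph on vertex set Fin V, given by a Boolean adjacency
-- function (symmetric and irreflexive for the graphs we build).

-- Proper edge-coloring with positive integer colours.  The colour of the
-- edge uv is c u v; only values on edges matter.
record ProperEdgeColoring (V : ℕ) (adj : Fin V → Fin V → Bool) : Set where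
  field
    col    : Fin V → Fin V → ℕ
    sym    : ∀ u v → adj u v ≡ true → col u v ≡ col v u
    pos    : ∀ u v → adj u v ≡ true → 1 ≤ col u v
    proper : ∀ u v w → adj u v ≡ true → adj u w ≡ true → v ≢ w → col u v ≢ col u w
open ProperEdgeColoring public

incidentColours : ∀ {V adj} → ProperEdgeColoring V adj → Fin V → List ℕ
incidentColours {V} {adj} α v = map (col α v) (filterᵇ (adj v) (allFin V))

S : ∀ {V adj} → ProperEdgeColoring V adj → Fin V → List ℕ
S α v = deduplicate ℕ._≟_ (incidentColours α v)

maxL : List ℕ → ℕ
maxL = foldr _⊔_ 0

minL : List ℕ → ℕ
minL [] = 0
minL (x ∷ xs) = foldr _⊓_ x xs

-- def(v,α) = max S - min S - |S| + 1  (0 if S is empty; note that for a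
-- nonempty set of distinct naturals max - min + 1 ≥ |S|, so truncated
-- subtraction is exact)
defV : ∀ {V adj} → ProperEdgeColoring V adj → Fin V → ℕ
defV α v with S α v
... | [] = 0
... | xs@(_ ∷ _) = (maxL xs ∸ minL xs + 1) ∸ length xs

totalDef : ∀ {V adj} → ProperEdgeColoring V adj → ℕ
totalDef {V} α = sum (map (defV α) (allFin V))

IsDeficiency : (V : ℕ) (adj : Fin V → Fin V → Bool) → ℕ → Set
IsDeficiency V adj d =
  Σ (ProperEdgeColoring V adj) (λ α → totalDef α ≡ d)
  × (∀ (α : ProperEdgeColoring V adj) → d ≤ totalDef α)

-- Complete multipartite graph with part sizes given by a list.
-- Vertices Fin (sum sizes); the first (head) block of vertices is part 0, etc.
partOf : (sizes : List ℕ) → Fin (sum sizes) → ℕ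
partOf []       ()
partOf (s ∷ ss) i with splitAt s i
... | inj₁ _ = 0
... | inj₂ j = suc (partOf ss j)

completeMultipartiteAdj : (sizes : List ℕ) → Fin (sum sizes) → Fin (sum sizes) → Bool
completeMultipartiteAdj sizes u v = not (partOf sizes u ≡ᵇ partOf sizes v)

sizesKnt : (n r t : ℕ) → List ℕ
sizesKnt n r t = replicate r n ++ ((t * r + 1) * n ∷ [])

module Submission where

-- Let m = r n.  The small parts and the first n vertices of the big part span K_{(r+1)×n}, which is
-- m-regular and, when n (r + 1) is even, has a proper edge colouring with m colours (a blown-up round
-- robin).  Colour it with 1, …, m and join the e-th of the remaining t m vertices of the big part to
-- the small vertices with the block of colours starting at m + 1 + ⌊e/m⌋ m, arranged as a Latin
-- square: every vertex then sees an interval.  Conversely, in an interval colouring a vertex of degree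
-- k m sees exactly k colours divisible by m; small vertices have degree (t + 1) m and big-part vertices
-- degree m, so counting the edges with such colours from both ends shows that r n (t + 1) + (t r + 1) n,
-- and hence n (r + 1), is even.

open import Defs hiding (sym)
open import Data.Nat using (ℕ; _*_; _+_; _≥_)
open import Data.Nat.Divisibility using (_∣_)
open import Data.Nat.ListAction using (sum)
open import Function.Bundles using (_⇔_)
open import Data.Bool using (Bool; true; false; not; _∧_; T?)
open import Data.Bool.Properties using (T-≡)
open import Data.Empty using (⊥-elim)
open import Data.Fin using (Fin; zero; suc; toℕ; splitAt; _↑ˡ_; _↑ʳ_)
open import Data.Fin.Properties using (splitAt-↑ˡ; splitAt-↑ʳ; splitAt⁻¹-↑ˡ; splitAt⁻¹-↑ʳ; toℕ-injective; toℕ<n)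
  renaming (_≟_ to _≟ᶠ_)
open import Data.List using (List; []; _∷_; _++_; map; filter; filterᵇ; tabulate; allFin; length; deduplicate; replicate)
open import Data.List.Membership.Propositional using (_∈_)
open import Data.List.Membership.Propositional.Properties
  using (∈-∃++; ∈-++⁻; ∈-++⁺ˡ; ∈-++⁺ʳ; ∈-filter⁺; ∈-filter⁻; ∈-map⁻; ∈-allFin)
open import Data.List.Properties using (length-++; length-++-sucʳ; length-map; filter-all; filter-++)
open import Data.List.Relation.Unary.All as All using (All; []; _∷_)
open import Data.List.Relation.Unary.AllPairs using ([]; _∷_)
open import Data.List.Relation.Unary.Any using (here; there)
open import Data.List.Relation.Unary.Unique.Propositional using (Unique)
open import Data.List.Relation.Unary.Unique.Propositional.Properties using (allFin⁺) renaming (filter⁺ to unique-filter⁺)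
open import Data.Nat
  using (zero; suc; _∸_; _≤_; _<_; _≡ᵇ_; _<?_; z≤n; s≤s; s≤s⁻¹; z<s; NonZero; ≢-nonZero; >-nonZero; _/_; _%_; pred)
open import Data.Nat.DivMod
open import Data.Nat.Divisibility using (_∣?_; divides; ∣m∣n⇒∣m+n; ∣m+n∣m⇒∣n; ∣-refl; ∣⇒≤)
open import Data.Nat.Primality using (euclidsLemma; prime[2])
open import Data.Nat.Properties
open import Data.Nat.Tactic.RingSolver using (solve-∀)
open import Data.Product using (∃; _×_; _,_; proj₁; proj₂)
open import Data.Sum using (inj₁; inj₂)
open import Function using (_∘_; id; case_of_)
open import Function.Bundles using (mk⇔; Equivalence)
open import Relation.Binary.PropositionalEquality
open import Relation.Nullary using (Dec; yes; no; does; ¬?)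
open import Relation.Nullary.Decidable using (dec-true; dec-false)
open import Algebra.Properties.CommutativeMonoid.Sum +-0-commutativeMonoid
  using (sum-cong-≗; ∑-distrib-+) renaming (sum to ∑)

indicator : Bool → ℕ
indicator true  = 1
indicator false = 0

∑-↑ : ∀ a b (f : Fin (a + b) → ℕ) → ∑ f ≡ ∑ (λ i → f (i ↑ˡ b)) + ∑ (λ j → f (a ↑ʳ j))
∑-↑ zero    b f = refl
∑-↑ (suc a) b f = trans (cong (f zero +_) (∑-↑ a b (f ∘ suc))) (sym (+-assoc (f zero) _ _))

∑-const : ∀ n c → ∑ {n} (λ _ → c) ≡ n * c
∑-const zero    c = refl
∑-const (suc n) c = cong (c +_) (∑-const n c)

∑∑-symmetric-even : ∀ n (M : Fin n → Fin n → ℕ) → (∀ i j → M i j ≡ M j i) → (∀ i → M i i ≡ 0) →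
                    2 ∣ ∑ (λ i → ∑ (M i))
∑∑-symmetric-even zero    M sym-M diag-M = divides 0 refl
∑∑-symmetric-even (suc n) M sym-M diag-M = subst (2 ∣_) (sym total) (∣m∣n⇒∣m+n (divides row refl) rest-even)
  where
  row rest : ℕ
  row  = ∑ (λ j → M zero (suc j))
  rest = ∑ (λ i → ∑ (λ j → M (suc i) (suc j)))
  rest-even : 2 ∣ rest
  rest-even = ∑∑-symmetric-even n (λ i j → M (suc i) (suc j)) (λ i j → sym-M (suc i) (suc j)) (diag-M ∘ suc)
  total : ∑ (λ i → ∑ (M i)) ≡ row * 2 + rest
  total = begin
    M zero zero + row + ∑ (λ i → M (suc i) zero + ∑ (λ j → M (suc i) (suc j)))
      ≡⟨ cong₂ _+_ (cong (_+ row) (diag-M zero)) (∑-distrib-+ (λ i → M (suc i) zero) _) ⟩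
    row + (∑ (λ i → M (suc i) zero) + rest)
      ≡⟨ cong (λ x → row + (x + rest)) (sum-cong-≗ (λ i → sym-M (suc i) zero)) ⟩
    row + (row + rest)
      ≡⟨ sym (+-assoc row row rest) ⟩
    row + row + rest
      ≡⟨ cong (_+ rest) (trans (cong (row +_) (sym (+-identityʳ row))) (*-comm 2 row)) ⟩
    row * 2 + rest ∎
    where open ≡-Reasoning

sum-map-≡0 : ∀ {A : Set} (f : A → ℕ) xs → (∀ x → f x ≡ 0) → sum (map f xs) ≡ 0
sum-map-≡0 f []       f≡0 = refl
sum-map-≡0 f (x ∷ xs) f≡0 = cong₂ _+_ (f≡0 x) (sum-map-≡0 f xs f≡0)

sum-map-≡0⁻ : ∀ {A : Set} (f : A → ℕ) {xs x} → sum (map f xs) ≡ 0 → x ∈ xs → f x ≡ 0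
sum-map-≡0⁻ f {y ∷ _} s≡0 (here refl) = m+n≡0⇒m≡0 (f y) s≡0
sum-map-≡0⁻ f {y ∷ _} s≡0 (there x∈) = sum-map-≡0⁻ f (m+n≡0⇒n≡0 (f y) s≡0) x∈

does-cong : ∀ {A B : Set} (a? : Dec A) (b? : Dec B) → A ⇔ B → does a? ≡ does b?
does-cong (yes _) (yes _) _   = refl
does-cong (no _)  (no _)  _   = refl
does-cong (yes a) (no ¬b) a⇔b = ⊥-elim (¬b (Equivalence.to a⇔b a))
does-cong (no ¬a) (yes b) a⇔b = ⊥-elim (¬a (Equivalence.from a⇔b b))

count : ∀ {A : Set} → (A → Bool) → List A → ℕ
count P xs = length (filterᵇ P xs)

count-∷ : ∀ {A : Set} (P : A → Bool) x xs → count P (x ∷ xs) ≡ indicator (P x) + count P xs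
count-∷ P x xs with P x
... | true  = refl
... | false = refl

count-++ : ∀ {A : Set} (P : A → Bool) xs ys → count P (xs ++ ys) ≡ count P xs + count P ys
count-++ P xs ys = trans (cong length (filter-++ (T? ∘ P) xs ys)) (length-++ (filterᵇ P xs))

count-+-count-not : ∀ {A : Set} (P : A → Bool) xs → count P xs + count (not ∘ P) xs ≡ length xs
count-+-count-not P []       = refl
count-+-count-not P (x ∷ xs) with P x
... | true  = cong suc (count-+-count-not P xs)
... | false = trans (+-suc _ _) (cong suc (count-+-count-not P xs))

count-≡0 : ∀ {A : Set} (P : A → Bool) {xs} → All (λ x → P x ≡ false) xs → count P xs ≡ 0
count-≡0 P []              = refl
count-≡0 P {x ∷ _} (Px ∷ ps) rewrite Px = count-≡0 P ps

count-map-filterᵇ : ∀ {A : Set} (Q : ℕ → Bool) (f : A → ℕ) (P : A → Bool) xs →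
                    count Q (map f (filterᵇ P xs)) ≡ count (λ x → P x ∧ Q (f x)) xs
count-map-filterᵇ Q f P []       = refl
count-map-filterᵇ Q f P (x ∷ xs) with P x
... | false = count-map-filterᵇ Q f P xs
... | true with Q (f x)
...   | true  = cong suc (count-map-filterᵇ Q f P xs)
...   | false = count-map-filterᵇ Q f P xs

count-tabulate : ∀ {A : Set} {n} (P : A → Bool) (f : Fin n → A) → count P (tabulate f) ≡ ∑ (λ i → indicator (P (f i)))
count-tabulate {n = zero}  P f = refl
count-tabulate {n = suc n} P f with P (f zero)
... | true  = cong suc (count-tabulate P (f ∘ suc))
... | false = count-tabulate P (f ∘ suc)

module _ {A : Set} (f : A → ℕ) (P : A → Bool) (f-inj : ∀ {x y} → P x ≡ true → P y ≡ true → f x ≡ f y → x ≡ y) where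

  private
    fresh : ∀ {x} xs → P x ≡ true → All (x ≢_) xs → All (f x ≢_) (map f (filterᵇ P xs))
    fresh []       Px []             = []
    fresh (y ∷ ys) Px (x≢y ∷ x∉ys) with P y in Py
    ... | true  = (λ fx≡fy → x≢y (f-inj Px Py fx≡fy)) ∷ fresh ys Px x∉ys
    ... | false = fresh ys Px x∉ys

  unique-map-filterᵇ : ∀ xs → Unique xs → Unique (map f (filterᵇ P xs))
  unique-map-filterᵇ []       []            = []
  unique-map-filterᵇ (x ∷ xs) (x∉xs ∷ u) with P x in Px
  ... | true  = fresh xs Px x∉xs ∷ unique-map-filterᵇ xs u
  ... | false = unique-map-filterᵇ xs u

unique⊆⇒length≤ : ∀ {A : Set} {xs ys : List A} → Unique xs → All (_∈ ys) xs → length xs ≤ length ys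
unique⊆⇒length≤ [] [] = z≤n
unique⊆⇒length≤ {xs = x ∷ xs} (x∉xs ∷ u) (x∈ys ∷ xs⊆ys) with ∈-∃++ x∈ys
... | as , bs , refl = subst (suc (length xs) ≤_) (sym (length-++-sucʳ as x bs))
        (s≤s (unique⊆⇒length≤ u (All.zipWith (λ (x≢y , y∈) → skip x≢y y∈) (x∉xs , xs⊆ys))))
  where
  skip : ∀ {y} → x ≢ y → y ∈ as ++ x ∷ bs → y ∈ as ++ bs
  skip x≢y y∈ with ∈-++⁻ as y∈
  ... | inj₁ y∈as         = ∈-++⁺ˡ y∈as
  ... | inj₂ (here refl)  = ⊥-elim (x≢y refl)
  ... | inj₂ (there y∈bs) = ∈-++⁺ʳ as y∈bs

unique⊆⇒count≤ : ∀ {A : Set} (P : A → Bool) {xs ys} → Unique xs → All (_∈ ys) xs → count P xs ≤ count P ys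
unique⊆⇒count≤ P u xs⊆ys = unique⊆⇒length≤ (unique-filter⁺ (T? ∘ P) u)
  (All.tabulate λ y∈ → let (y∈xs , Py) = ∈-filter⁻ (T? ∘ P) y∈ in ∈-filter⁺ (T? ∘ P) (All.lookup xs⊆ys y∈xs) Py)

unique⊆⇒count≡ : ∀ {A : Set} (P : A → Bool) {xs ys} → Unique xs → All (_∈ ys) xs → length xs ≡ length ys →
                 count P xs ≡ count P ys
unique⊆⇒count≡ P {xs} {ys} u xs⊆ys len≡ = ≤-antisym (unique⊆⇒count≤ P u xs⊆ys) (+-cancelʳ-≤ _ _ _ (begin
  count P ys + count (not ∘ P) xs ≤⟨ +-monoʳ-≤ (count P ys) (unique⊆⇒count≤ (not ∘ P) u xs⊆ys) ⟩
  count P ys + count (not ∘ P) ys ≡⟨ count-+-count-not P ys ⟩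
  length ys                       ≡⟨ sym len≡ ⟩
  length xs                       ≡⟨ sym (count-+-count-not P xs) ⟩
  count P xs + count (not ∘ P) xs ∎))
  where open ≤-Reasoning

-- Deficiency zero as windows of colours

Window : ℕ → ℕ → List ℕ → Set
Window lo k = All (λ c → lo ≤ c × c < lo + k)

≤maxL : ∀ {y} xs → y ∈ xs → y ≤ maxL xs
≤maxL (x ∷ xs) (here refl) = m≤m⊔n x (maxL xs)
≤maxL (x ∷ xs) (there y∈)  = ≤-trans (≤maxL xs y∈) (m≤n⊔m x (maxL xs))

minL≤ : ∀ {y} x xs → y ∈ x ∷ xs → minL (x ∷ xs) ≤ y
minL≤ x []       (here refl)         = ≤-refl
minL≤ x (z ∷ zs) (here refl)         = ≤-trans (m⊓n≤n z _) (minL≤ x zs (here refl))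
minL≤ x (z ∷ zs) (there (here refl)) = m⊓n≤m z _
minL≤ x (z ∷ zs) (there (there y∈))  = ≤-trans (m⊓n≤n z _) (minL≤ x zs (there y∈))

maxL-∈ : ∀ x xs → maxL (x ∷ xs) ∈ x ∷ xs
maxL-∈ x []       = here (⊔-identityʳ x)
maxL-∈ x (y ∷ ys) with ⊔-sel x (maxL (y ∷ ys))
... | inj₁ eq = here eq
... | inj₂ eq = there (subst (_∈ y ∷ ys) (sym eq) (maxL-∈ y ys))

minL-∈ : ∀ x xs → minL (x ∷ xs) ∈ x ∷ xs
minL-∈ x []       = here refl
minL-∈ x (y ∷ ys) with ⊓-sel y (minL (x ∷ ys)) | minL-∈ x ys
... | inj₁ eq | _         = there (here eq)
... | inj₂ eq | here p    = here (trans eq p)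
... | inj₂ eq | there min∈ = there (there (subst (_∈ ys) (sym eq) min∈))

spread≤⇔ : ∀ {mn mx} k → mn ≤ mx → (mx ∸ mn + 1 ≤ k) ⇔ (mx < mn + k)
spread≤⇔ {mn} {mx} k mn≤mx = mk⇔
  (λ le → subst (_≤ mn + k) shift (+-monoʳ-≤ mn (subst (_≤ k) (+-comm _ 1) le)))
  (λ lt → subst (_≤ k) (+-comm 1 _) (+-cancelˡ-≤ mn _ _ (subst (_≤ mn + k) (sym shift) lt)))
  where
  shift : mn + suc (mx ∸ mn) ≡ suc mx
  shift = trans (+-suc mn _) (cong suc (m+[n∸m]≡n mn≤mx))

module _ (x : ℕ) (xs : List ℕ) where

  private
    mn mx k : ℕ
    mn = minL (x ∷ xs)
    mx = maxL (x ∷ xs)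
    k  = length (x ∷ xs)
    mn≤mx : mn ≤ mx
    mn≤mx = ≤-trans (minL≤ x xs (here refl)) (≤maxL (x ∷ xs) (here refl))

  window⇒gap≡0 : ∀ {lo} → Window lo k (x ∷ xs) → (mx ∸ mn + 1) ∸ k ≡ 0
  window⇒gap≡0 {lo} w = m≤n⇒m∸n≡0 (Equivalence.from (spread≤⇔ k mn≤mx) (begin-strict
    mx     <⟨ proj₂ (All.lookup w (maxL-∈ x xs)) ⟩
    lo + k ≤⟨ +-monoˡ-≤ k (proj₁ (All.lookup w (minL-∈ x xs))) ⟩
    mn + k ∎))
    where open ≤-Reasoning

  gap≡0⇒window : (mx ∸ mn + 1) ∸ k ≡ 0 → Window mn k (x ∷ xs)
  gap≡0⇒window gap≡0 = All.tabulate λ c∈ →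
    minL≤ x xs c∈ , ≤-<-trans (≤maxL (x ∷ xs) c∈) (Equivalence.to (spread≤⇔ k mn≤mx) (m∸n≡0⇒m≤n gap≡0))

module _ {V adj} (α : ProperEdgeColoring V adj) (v : Fin V) where

  incidentColours-unique : Unique (incidentColours α v)
  incidentColours-unique = unique-map-filterᵇ (col α v) (adj v) injective (allFin V) (allFin⁺ V)
    where
    injective : ∀ {w w′} → adj v w ≡ true → adj v w′ ≡ true → col α v w ≡ col α v w′ → w ≡ w′
    injective {w} {w′} vw vw′ eq with w ≟ᶠ w′
    ... | yes w≡w′ = w≡w′
    ... | no  w≢w′ = ⊥-elim (proper α v w w′ vw vw′ w≢w′ eq)

  S≡incidentColours : S α v ≡ incidentColours α v
  S≡incidentColours = deduplicate-unique incidentColours-unique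
    where
    deduplicate-unique : ∀ {xs} → Unique xs → deduplicate _≟_ xs ≡ xs
    deduplicate-unique {[]}     []          = refl
    deduplicate-unique {x ∷ xs} (x∉xs ∷ u) =
      cong (x ∷_) (trans (cong (filter (¬? ∘ (x ≟_))) (deduplicate-unique u)) (filter-all (¬? ∘ (x ≟_)) x∉xs))

  defV≡0⇔window : defV α v ≡ 0 ⇔ ∃ λ lo → Window lo (length (incidentColours α v)) (incidentColours α v)
  defV≡0⇔window = mk⇔ to from
    where
    SelfWindow : ℕ → List ℕ → Set
    SelfWindow lo xs = Window lo (length xs) xs
    to : defV α v ≡ 0 → ∃ λ lo → SelfWindow lo (incidentColours α v)
    to gap≡0 with S α v | S≡incidentColours
    ... | []     | eq = 0 , subst (SelfWindow 0) eq []
    ... | x ∷ xs | eq = minL (x ∷ xs) , subst (SelfWindow (minL (x ∷ xs))) eq (gap≡0⇒window x xs gap≡0)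
    from : (∃ λ lo → SelfWindow lo (incidentColours α v)) → defV α v ≡ 0
    from (lo , w) with S α v | S≡incidentColours
    ... | []     | _  = refl
    ... | x ∷ xs | eq = window⇒gap≡0 x xs (subst (SelfWindow lo) (sym eq) w)

-- Multiples of m in a window

interval : ℕ → ℕ → List ℕ
interval lo zero    = []
interval lo (suc k) = lo ∷ interval (suc lo) k

length-interval : ∀ lo k → length (interval lo k) ≡ k
length-interval lo zero    = refl
length-interval lo (suc k) = cong suc (length-interval (suc lo) k)

∈-interval : ∀ {lo c} k → lo ≤ c → c < lo + k → c ∈ interval lo k
∈-interval {lo} zero    lo≤c c<lo+0 = ⊥-elim (<⇒≱ (subst (_ <_) (+-identityʳ lo) c<lo+0) lo≤c)
∈-interval {lo} {c} (suc k) lo≤c c<lo+k with lo ≟ c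
... | yes refl = here refl
... | no  lo≢c = there (∈-interval k (≤∧≢⇒< lo≤c lo≢c) (subst (c <_) (+-suc lo k) c<lo+k))

interval-window : ∀ lo k → Window lo k (interval lo k)
interval-window lo zero    = []
interval-window lo (suc k) = (≤-refl , m<m+n lo z<s)
  ∷ All.map (λ {c} (lo<c , c<) → <⇒≤ lo<c , subst (c <_) (sym (+-suc lo k)) c<) (interval-window (suc lo) k)

interval-+ : ∀ lo a b → interval lo (a + b) ≡ interval lo a ++ interval (lo + a) b
interval-+ lo zero    b = cong (λ x → interval x b) (sym (+-identityʳ lo))
interval-+ lo (suc a) b = cong (lo ∷_) (trans (interval-+ (suc lo) a b)
  (cong (λ x → interval (suc lo) a ++ interval x b) (sym (+-suc lo a))))

multipleOf : ℕ → ℕ → Bool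
multipleOf m c = does (m ∣? c)

count-multiples-block : ∀ m lo → count (multipleOf (suc m)) (interval lo (suc m)) ≡ 1
count-multiples-block m zero = begin
  count P (0 ∷ interval 1 m)          ≡⟨ count-∷ P 0 (interval 1 m) ⟩
  indicator (P 0) + count P (interval 1 m)
    ≡⟨ cong₂ (λ b c → indicator b + c) (dec-true (suc m ∣? 0) (divides 0 refl))
             (count-≡0 P (All.map nonMultiple (interval-window 1 m))) ⟩
  1 ∎
  where
  open ≡-Reasoning
  P : ℕ → Bool
  P = multipleOf (suc m)
  nonMultiple : ∀ {c} → 1 ≤ c × c < 1 + m → P c ≡ false
  nonMultiple {suc c} (_ , c<1+m) = dec-false (suc m ∣? suc c) (λ m∣c → <⇒≱ c<1+m (∣⇒≤ m∣c))
count-multiples-block m (suc lo) = begin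
  count P (interval (suc lo) (suc m))
    ≡⟨ cong (count P) (trans (cong (interval (suc lo)) (+-comm 1 m)) (interval-+ (suc lo) m 1)) ⟩
  count P (interval (suc lo) m ++ (suc lo + m) ∷ [])          ≡⟨ count-++ P (interval (suc lo) m) _ ⟩
  count P (interval (suc lo) m) + count P ((suc lo + m) ∷ []) ≡⟨ cong (count P (interval (suc lo) m) +_) same-ends ⟩
  count P (interval (suc lo) m) + count P (lo ∷ [])           ≡⟨ +-comm (count P (interval (suc lo) m)) _ ⟩
  count P (lo ∷ []) + count P (interval (suc lo) m)           ≡⟨ count-++ P (lo ∷ []) (interval (suc lo) m) ⟨
  count P (interval lo (suc m))                               ≡⟨ count-multiples-block m lo ⟩
  1 ∎
  where
  open ≡-Reasoning
  P : ℕ → Bool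
  P = multipleOf (suc m)
  P[lo+m]≡P[lo] : P (suc lo + m) ≡ P lo
  P[lo+m]≡P[lo] = does-cong (suc m ∣? (suc lo + m)) (suc m ∣? lo) (mk⇔
    (λ m∣ → ∣m+n∣m⇒∣n (subst (suc m ∣_) (cong suc (+-comm lo m)) m∣) ∣-refl)
    (λ m∣ → subst (suc m ∣_) (+-suc lo m) (∣m∣n⇒∣m+n m∣ ∣-refl)))
  same-ends : count P ((suc lo + m) ∷ []) ≡ count P (lo ∷ [])
  same-ends = trans (count-∷ P (suc lo + m) [])
    (trans (cong (λ b → indicator b + 0) P[lo+m]≡P[lo]) (sym (count-∷ P lo [])))

count-multiples-interval : ∀ m lo k → count (multipleOf (suc m)) (interval lo (k * suc m)) ≡ k
count-multiples-interval m lo zero    = refl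
count-multiples-interval m lo (suc k) = begin
  count P (interval lo (suc m + k * suc m))                          ≡⟨ cong (count P) (interval-+ lo (suc m) (k * suc m)) ⟩
  count P (interval lo (suc m) ++ interval (lo + suc m) (k * suc m)) ≡⟨ count-++ P (interval lo (suc m)) _ ⟩
  count P (interval lo (suc m)) + count P (interval (lo + suc m) (k * suc m))
    ≡⟨ cong₂ _+_ (count-multiples-block m lo) (count-multiples-interval m (lo + suc m) k) ⟩
  suc k ∎
  where
  open ≡-Reasoning
  P : ℕ → Bool
  P = multipleOf (suc m)

window-count-multiples : ∀ m .{{_ : NonZero m}} {xs lo k} → Unique xs → Window lo (length xs) xs →
                         length xs ≡ k * m → count (multipleOf m) xs ≡ k
window-count-multiples (suc m) {xs} {lo} {k} u w len≡ = begin
  count (multipleOf (suc m)) xs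
    ≡⟨ unique⊆⇒count≡ _ u xs⊆interval (sym (length-interval lo (length xs))) ⟩
  count (multipleOf (suc m)) (interval lo (length xs))
    ≡⟨ cong (λ l → count (multipleOf (suc m)) (interval lo l)) len≡ ⟩
  count (multipleOf (suc m)) (interval lo (k * suc m))
    ≡⟨ count-multiples-interval m lo k ⟩
  k ∎
  where
  open ≡-Reasoning
  xs⊆interval : All (_∈ interval lo (length xs)) xs
  xs⊆interval = All.map (λ (lo≤c , c<) → ∈-interval (length xs) lo≤c c<) w

-- Interval colourings

degree : ∀ {V} → (Fin V → Fin V → Bool) → Fin V → ℕ
degree {V} adj u = count (adj u) (allFin V)

module _ {V adj} (α : ProperEdgeColoring V adj) where

  length-incidentColours : ∀ u → length (incidentColours α u) ≡ degree adj u
  length-incidentColours u = length-map (col α u) (filterᵇ (adj u) (allFin V))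

  neighbourWindow⇒defV≡0 : ∀ u lo → (∀ w → adj u w ≡ true → lo ≤ col α u w × col α u w < lo + degree adj u) →
                           defV α u ≡ 0
  neighbourWindow⇒defV≡0 u lo window = Equivalence.from (defV≡0⇔window α u) (lo , All.tabulate λ {c} c∈ →
    let (w , w∈ , c≡) = ∈-map⁻ (col α u) c∈
        (_ , uw)      = ∈-filter⁻ (T? ∘ adj u) {xs = allFin V} w∈
    in subst (λ c → lo ≤ c × c < lo + length (incidentColours α u)) (sym c≡)
         (subst (λ d → lo ≤ col α u w × col α u w < lo + d) (sym (length-incidentColours u))
           (window w (Equivalence.to T-≡ uw))))

  totalDef≡0⇔ : totalDef α ≡ 0 ⇔ (∀ u → defV α u ≡ 0)
  totalDef≡0⇔ = mk⇔ (λ total≡0 u → sum-map-≡0⁻ (defV α) total≡0 (∈-allFin u)) (sum-map-≡0 (defV α) (allFin V))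

  intervalColouring⇒even : (∀ u w → adj u w ≡ adj w u) → (∀ u → adj u u ≡ false) → totalDef α ≡ 0 →
                           ∀ m .{{_ : NonZero m}} (k : Fin V → ℕ) → (∀ u → degree adj u ≡ k u * m) → 2 ∣ ∑ k
  intervalColouring⇒even adj-sym adj-irrefl total≡0 m k degree≡ =
    subst (2 ∣_) (sum-cong-≗ row≡k) (∑∑-symmetric-even V M M-sym M-diag)
    where
    M : Fin V → Fin V → ℕ
    M u w = indicator (adj u w ∧ multipleOf m (col α u w))
    M-sym : ∀ u w → M u w ≡ M w u
    M-sym u w rewrite adj-sym u w with adj w u in wu
    ... | true  = cong (λ c → indicator (multipleOf m c)) (ProperEdgeColoring.sym α u w (trans (adj-sym u w) wu))
    ... | false = refl
    M-diag : ∀ u → M u u ≡ 0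
    M-diag u rewrite adj-irrefl u = refl
    row≡k : ∀ u → ∑ (M u) ≡ k u
    row≡k u with Equivalence.to (defV≡0⇔window α u) (Equivalence.to totalDef≡0⇔ total≡0 u)
    ... | lo , window = begin
      ∑ (M u)
        ≡⟨ count-tabulate (λ w → adj u w ∧ multipleOf m (col α u w)) id ⟨
      count (λ w → adj u w ∧ multipleOf m (col α u w)) (allFin V)
        ≡⟨ count-map-filterᵇ (multipleOf m) (col α u) (adj u) (allFin V) ⟨
      count (multipleOf m) (incidentColours α u)
        ≡⟨ window-count-multiples m (incidentColours-unique α u) window (trans (length-incidentColours u) (degree≡ u)) ⟩
      k u ∎
      where open ≡-Reasoning

module _ {m : ℕ} .{{_ : NonZero m}} where

  divMod-unique : ∀ {q q′ ρ ρ′} → ρ < m → ρ′ < m → q * m + ρ ≡ q′ * m + ρ′ → q ≡ q′ × ρ ≡ ρ′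
  divMod-unique {q} {q′} {ρ} {ρ′} ρ<m ρ′<m eq = q≡q′ , ρ≡ρ′
    where
    ρ≡ρ′ : ρ ≡ ρ′
    ρ≡ρ′ = begin
      ρ                 ≡⟨ m<n⇒m%n≡m ρ<m ⟨
      ρ % m             ≡⟨ [m+kn]%n≡m%n ρ q m ⟨
      (ρ + q * m) % m   ≡⟨ cong (_% m) (+-comm ρ (q * m)) ⟩
      (q * m + ρ) % m   ≡⟨ cong (_% m) eq ⟩
      (q′ * m + ρ′) % m ≡⟨ cong (_% m) (+-comm (q′ * m) ρ′) ⟩
      (ρ′ + q′ * m) % m ≡⟨ [m+kn]%n≡m%n ρ′ q′ m ⟩
      ρ′ % m            ≡⟨ m<n⇒m%n≡m ρ′<m ⟩
      ρ′                ∎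
      where open ≡-Reasoning
    q≡q′ : q ≡ q′
    q≡q′ = *-cancelʳ-≡ q q′ m (+-cancelʳ-≡ ρ (q * m) (q′ * m) (trans eq (cong (q′ * m +_) (sym ρ≡ρ′))))

  -- Adding m ∸ a % m undoes adding a.
  divMod-injective : ∀ {x y} → x / m ≡ y / m → x % m ≡ y % m → x ≡ y
  divMod-injective {x} {y} q≡ ρ≡ =
    trans (m≡m%n+[m/n]*n x m) (trans (cong₂ (λ ρ q → ρ + q * m) ρ≡ q≡) (sym (m≡m%n+[m/n]*n y m)))

  %-cancel-+ʳ : ∀ a {x y} → (x + a) % m ≡ (y + a) % m → x % m ≡ y % m
  %-cancel-+ʳ a {x} {y} eq = trans (undo x) (trans (cong (λ z → (z + b % m) % m) eq) (sym (undo y)))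
    where
    b : ℕ
    b = m ∸ a % m
    a+b : a + b ≡ suc (a / m) * m
    a+b = begin
      a + b                         ≡⟨ cong (_+ b) (trans (m≡m%n+[m/n]*n a m) (+-comm (a % m) _)) ⟩
      (a / m) * m + a % m + b       ≡⟨ +-assoc ((a / m) * m) (a % m) b ⟩
      (a / m) * m + (a % m + b)     ≡⟨ cong ((a / m) * m +_) (m+[n∸m]≡n (m%n≤n a m)) ⟩
      (a / m) * m + m               ≡⟨ +-comm ((a / m) * m) m ⟩
      suc (a / m) * m               ∎
      where open ≡-Reasoning
    undo : ∀ z → z % m ≡ ((z + a) % m + b % m) % m
    undo z = begin
      z % m                         ≡⟨ [m+kn]%n≡m%n z (suc (a / m)) m ⟨
      (z + suc (a / m) * m) % m     ≡⟨ cong (λ w → (z + w) % m) a+b ⟨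
      (z + (a + b)) % m             ≡⟨ cong (_% m) (+-assoc z a b) ⟨
      (z + a + b) % m               ≡⟨ %-distribˡ-+ (z + a) b m ⟩
      ((z + a) % m + b % m) % m     ∎
      where open ≡-Reasoning

  %-cancel-+ˡ : ∀ a {x y} → (a + x) % m ≡ (a + y) % m → x % m ≡ y % m
  %-cancel-+ˡ a {x} {y} eq = %-cancel-+ʳ a (trans (cong (_% m) (+-comm x a)) (trans eq (cong (_% m) (+-comm a y))))

  %-injective-< : ∀ {x y} → x < m → y < m → x % m ≡ y % m → x ≡ y
  %-injective-< x<m y<m eq = trans (sym (m<n⇒m%n≡m x<m)) (trans eq (m<n⇒m%n≡m y<m))

  *+<-bound : ∀ {q c ρ} → q < c → ρ < m → q * m + ρ < c * m
  *+<-bound {q} {c} {ρ} q<c ρ<m = begin-strict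
    q * m + ρ ≡⟨ +-comm (q * m) ρ ⟩
    ρ + q * m <⟨ +-monoˡ-< (q * m) ρ<m ⟩
    suc q * m ≤⟨ *-monoˡ-≤ m q<c ⟩
    c * m     ∎
    where open ≤-Reasoning

%-*-congˡ : ∀ {m} .{{_ : NonZero m}} z c → (z * c) % m ≡ ((z % m) * c) % m
%-*-congˡ {m} z c = trans (%-distribˡ-* z c m)
  (sym (trans (%-distribˡ-* (z % m) c m) (cong (λ w → (w * (c % m)) % m) (m%n%n≡m%n z m))))

-- k + 1 is the inverse of 2 modulo 2k + 1.
double-%-cancel : ∀ k {x y} → (x + x) % suc (2 * k) ≡ (y + y) % suc (2 * k) → x % suc (2 * k) ≡ y % suc (2 * k)
double-%-cancel k {x} {y} eq = trans (halve x) (trans (cong (λ z → (z * suc k) % K) eq) (sym (halve y)))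
  where
  K : ℕ
  K = suc (2 * k)
  halve : ∀ z → z % K ≡ ((z + z) % K * suc k) % K
  halve z = begin
    z % K                  ≡⟨ [m+kn]%n≡m%n z z K ⟨
    (z + z * K) % K        ≡⟨ cong (_% K) (double-inverse z k) ⟩
    ((z + z) * suc k) % K  ≡⟨ %-*-congˡ (z + z) (suc k) ⟩
    ((z + z) % K * suc k) % K ∎
    where
    open ≡-Reasoning
    double-inverse : ∀ z k → z + z * suc (2 * k) ≡ (z + z) * suc k
    double-inverse = solve-∀

-- Proper colourings of K_{(r+1)×n} with r n colours

record ProperColouring {A : Set} (Adj : A → A → Set) (c : ℕ) : Set where
  field
    colour     : A → A → ℕ
    colour<    : ∀ {x y} → Adj x y → colour x y < c
    colour-sym : ∀ {x y} → Adj x y → colour x y ≡ colour y x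
    colour-inj : ∀ {x y z} → Adj x y → Adj x z → colour x y ≡ colour x z → y ≡ z
open ProperColouring

Complete : ℕ → ℕ → ℕ → Set
Complete N x y = x < N × y < N × x ≢ y

-- BlowUp n (Complete (suc r)) is K_{(r+1)×n}, with vertex (p , i) the i-th vertex of part p.
BlowUp : ∀ {A : Set} → ℕ → (A → A → Set) → A × ℕ → A × ℕ → Set
BlowUp n Adj (x , i) (y , j) = Adj x y × i < n × j < n

blowUp : ∀ {A} {Adj : A → A → Set} {c} n .{{_ : NonZero n}} → ProperColouring Adj c → ProperColouring (BlowUp n Adj) (c * n)
blowUp {A} {Adj} {c} n C = record { colour = blown ; colour< = blown< ; colour-sym = blown-sym ; colour-inj = blown-inj }
  where
  blown : A × ℕ → A × ℕ → ℕ
  blown (x , i) (y , j) = colour C x y * n + (i + j) % n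
  blown< : ∀ {u v} → BlowUp n Adj u v → blown u v < c * n
  blown< {x , i} {y , j} (xy , _) = *+<-bound (colour< C xy) (m%n<n (i + j) n)
  blown-sym : ∀ {u v} → BlowUp n Adj u v → blown u v ≡ blown v u
  blown-sym {x , i} {y , j} (xy , _) = cong₂ (λ a b → a * n + b) (colour-sym C xy) (cong (_% n) (+-comm i j))
  blown-inj : ∀ {u v w} → BlowUp n Adj u v → BlowUp n Adj u w → blown u v ≡ blown u w → v ≡ w
  blown-inj {x , i} {y , j} {z , k} (xy , _ , j<n) (xz , _ , k<n) eq
    with divMod-unique (m%n<n (i + j) n) (m%n<n (i + k) n) eq
  ... | colour≡ , residue≡ =
    cong₂ _,_ (colour-inj C xy xz colour≡) (%-injective-< j<n k<n (%-cancel-+ˡ i residue≡))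

dropColour0 : ∀ {A} {Adj : A → A → Set} {c} (C : ProperColouring Adj (suc c)) →
              ProperColouring (λ x y → Adj x y × NonZero (colour C x y)) c
dropColour0 C = record
  { colour     = λ x y → pred (colour C x y)
  ; colour<    = λ (xy , nz) → pred-mono-< {{nz}} (colour< C xy)
  ; colour-sym = λ (xy , _) → cong pred (colour-sym C xy)
  ; colour-inj = λ (xy , nz) (xz , nz′) eq → colour-inj C xy xz (pred-injective {{nz}} {{nz′}} eq)
  }

pullback : ∀ {A B} {Adj : A → A → Set} {Adj′ : B → B → Set} {c} (φ : B → A) →
           (∀ {x y} → Adj′ x y → Adj (φ x) (φ y)) →
           (∀ {x y z} → Adj′ x y → Adj′ x z → φ y ≡ φ z → y ≡ z) →
           ProperColouring Adj c → ProperColouring Adj′ c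
pullback φ φ-adj φ-inj C = record
  { colour     = λ x y → colour C (φ x) (φ y)
  ; colour<    = λ xy → colour< C (φ-adj xy)
  ; colour-sym = λ xy → colour-sym C (φ-adj xy)
  ; colour-inj = λ xy xz eq → φ-inj xy xz (colour-inj C (φ-adj xy) (φ-adj xz) eq)
  }

-- The classical 1-factorisation of K_{2k+2}: on ℤ_{2k+1} ∪ {∞}, with ∞ represented by K, colour xy by
-- x + y and x∞ by 2x.
module RoundRobin (k : ℕ) where

  K : ℕ
  K = suc (2 * k)

  _∞↦_ : ℕ → ℕ → ℕ
  x ∞↦ y with x ≟ K
  ... | yes _ = y
  ... | no  _ = x

  rr : ℕ → ℕ → ℕ
  rr x y = ((x ∞↦ y) + (y ∞↦ x)) % K

  private
    K∞↦ : ∀ y → K ∞↦ y ≡ y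
    K∞↦ y with K ≟ K
    ... | yes _  = refl
    ... | no K≢K = ⊥-elim (K≢K refl)

    <∞↦ : ∀ {x} y → x < K → x ∞↦ y ≡ x
    <∞↦ {x} y x<K with x ≟ K
    ... | yes refl = ⊥-elim (<-irrefl refl x<K)
    ... | no  _    = refl

  data Point : ℕ → Set where
    ∞      : Point K
    finite : ∀ {x} → x < K → Point x

  point : ∀ {x} → x < suc K → Point x
  point x<1+K with m≤n⇒m<n∨m≡n (s≤s⁻¹ x<1+K)
  ... | inj₁ x<K  = finite x<K
  ... | inj₂ refl = ∞

  rr-∞ʳ : ∀ {x} → x < K → rr x K ≡ (x + x) % K
  rr-∞ʳ {x} x<K rewrite <∞↦ K x<K | K∞↦ x = refl

  rr-∞ˡ : ∀ {y} → y < K → rr K y ≡ (y + y) % K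
  rr-∞ˡ {y} y<K rewrite <∞↦ K y<K | K∞↦ y = refl

  rr-finite : ∀ {x y} → x < K → y < K → rr x y ≡ (x + y) % K
  rr-finite {x} {y} x<K y<K rewrite <∞↦ y x<K | <∞↦ x y<K = refl

  rr-sym : ∀ x y → rr x y ≡ rr y x
  rr-sym x y = cong (_% K) (+-comm (x ∞↦ y) (y ∞↦ x))

  rr-inj : ∀ {x y z} → Complete (suc K) x y → Complete (suc K) x z → rr x y ≡ rr x z → y ≡ z
  rr-inj {x} {y} {z} (x< , y< , x≢y) (_ , z< , x≢z) eq with point x< | point y< | point z<
  ... | ∞ | ∞ | _ = ⊥-elim (x≢y refl)
  ... | ∞ | _ | ∞ = ⊥-elim (x≢z refl)
  ... | ∞ | finite y<K | finite z<K =
    %-injective-< y<K z<K (double-%-cancel k {y} {z} (trans (sym (rr-∞ˡ y<K)) (trans eq (rr-∞ˡ z<K))))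
  ... | finite _   | ∞ | ∞ = refl
  ... | finite x<K | ∞ | finite z<K =
    ⊥-elim (x≢z (%-injective-< x<K z<K (%-cancel-+ˡ {K} x (trans (sym (rr-∞ʳ x<K)) (trans eq (rr-finite x<K z<K))))))
  ... | finite x<K | finite y<K | ∞ =
    ⊥-elim (x≢y (%-injective-< x<K y<K (%-cancel-+ˡ {K} x (trans (sym (rr-∞ʳ x<K)) (trans (sym eq) (rr-finite x<K y<K))))))
  ... | finite x<K | finite y<K | finite z<K =
    %-injective-< y<K z<K (%-cancel-+ˡ {K} x (trans (sym (rr-finite x<K y<K)) (trans eq (rr-finite x<K z<K))))

  roundRobin : ProperColouring (Complete (suc K)) K
  roundRobin = record
    { colour     = rr
    ; colour<    = λ {x} {y} _ → m%n<n ((x ∞↦ y) + (y ∞↦ x)) K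
    ; colour-sym = λ {x} {y} _ → rr-sym x y
    ; colour-inj = rr-inj
    }

  rr-complement : ∀ {x} → x < suc K → rr x (K ∸ x) ≡ 0
  rr-complement x< with point x<
  ... | ∞ rewrite n∸n≡0 K = rr-∞ˡ z<s
  rr-complement {zero}  x< | finite _ = rr-∞ʳ z<s
  rr-complement {suc x} x< | finite x<K = trans (rr-finite x<K (∸-monoʳ-< z<s (<⇒≤ x<K)))
    (trans (cong (_% K) (m+[n∸m]≡n (<⇒≤ x<K))) (n%n≡0 K))

  rr≡0⇒complement : ∀ {x y} → Complete (suc K) x y → rr x y ≡ 0 → y ≡ K ∸ x
  rr≡0⇒complement {x} xy@(x< , _) rr≡0 =
    rr-inj xy (x< , s≤s (m∸n≤m K x) , x≢K∸x) (trans rr≡0 (sym (rr-complement x<)))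
    where
    x≢K∸x : x ≢ K ∸ x
    x≢K∸x x≡ = even≢odd x k (trans (cong (x +_) (trans (+-identityʳ x) x≡)) (m+[n∸m]≡n (s≤s⁻¹ x<)))

-- Placing part p of K_{(r+1)×2} on the vertices p and K ∸ p of K_{2r+2} turns its non-edges into
-- exactly the colour-0 edges of the round robin.
module CocktailParty (r : ℕ) where
  open RoundRobin r

  slot : ℕ × ℕ → ℕ
  slot (p , zero)  = p
  slot (p , suc _) = K ∸ p

  private
    r<K : r < K
    r<K = s≤s (m≤m+n r (r + 0))

    low≤K : ∀ {p} → p < suc r → p ≤ K
    low≤K p≤r = <⇒≤ (≤-trans p≤r r<K)

    low<high : ∀ {p q} → p < suc r → q < suc r → p < K ∸ q
    low<high {p} {q} p≤r q≤r = +-cancelʳ-< q p (K ∸ q) (begin-strict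
      p + q       ≤⟨ +-mono-≤ (s≤s⁻¹ p≤r) (s≤s⁻¹ q≤r) ⟩
      r + r       <⟨ s≤s (≤-reflexive (cong (r +_) (sym (+-identityʳ r)))) ⟩
      K           ≡⟨ m∸n+n≡m (<⇒≤ (≤-trans q≤r r<K)) ⟨
      K ∸ q + q   ∎)
      where open ≤-Reasoning

  slot< : ∀ {p s} → p < suc r → slot (p , s) < suc K
  slot< {s = zero}  p≤r = s≤s (low≤K p≤r)
  slot< {p} {s = suc _} _ = s≤s (m∸n≤m K p)

  slot-complement : ∀ {p s} → p < suc r → s < 2 → K ∸ slot (p , s) ≡ slot (p , 1 ∸ s)
  slot-complement {s = zero}  p≤r _               = refl
  slot-complement {s = suc _} p≤r (s≤s (s≤s z≤n)) = m∸[m∸n]≡n (low≤K p≤r)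

  slot-injective : ∀ {p q s s′} → p < suc r → q < suc r → s < 2 → s′ < 2 →
                   slot (p , s) ≡ slot (q , s′) → (p , s) ≡ (q , s′)
  slot-injective {s = zero}  {zero}  _   _   _               _               refl = refl
  slot-injective {s = zero}  {suc _} p≤r q≤r _               _               eq   = ⊥-elim (<⇒≢ (low<high p≤r q≤r) eq)
  slot-injective {s = suc _} {zero}  p≤r q≤r _               _               eq   = ⊥-elim (<⇒≢ (low<high q≤r p≤r) (sym eq))
  slot-injective {s = suc _} {suc _} p≤r q≤r (s≤s (s≤s z≤n)) (s≤s (s≤s z≤n)) eq =
    cong (_, 1) (∸-cancelˡ-≡ (low≤K p≤r) (low≤K q≤r) eq)

  private
    Adj : ℕ × ℕ → ℕ × ℕ → Set
    Adj = BlowUp 2 (Complete (suc r))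

    slot-adjacent : ∀ {u v} → Adj u v → Complete (suc K) (slot u) (slot v) × NonZero (rr (slot u) (slot v))
    slot-adjacent {p , s} {q , s′} ((p≤r , q≤r , p≢q) , s<2 , s′<2) =
      complete , ≢-nonZero (λ rr≡0 → p≢q (cong proj₁ (sym (slot-injective q≤r p≤r s′<2 (s≤s (m∸n≤m 1 s))
        (trans (rr≡0⇒complement complete rr≡0) (slot-complement {s = s} p≤r s<2))))))
      where
      complete : Complete (suc K) (slot (p , s)) (slot (q , s′))
      complete = slot< {s = s} p≤r , slot< {s = s′} q≤r , λ eq → p≢q (cong proj₁ (slot-injective p≤r q≤r s<2 s′<2 eq))

  cocktailParty : ProperColouring (BlowUp 2 (Complete (suc r))) (2 * r)
  cocktailParty = pullback slot slot-adjacent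
    (λ ((_ , q≤r , _) , _ , s′<2) ((_ , q′≤r , _) , _ , s″<2) → slot-injective q≤r q′≤r s′<2 s″<2)
    (dropColour0 roundRobin)

-- K_{(r+1)×2h} is the h-fold blow-up of K_{(r+1)×2}, via (p , i) ↦ ((p , i / h) , i % h).
evenMultipartite : ∀ h r .{{_ : NonZero h}} → ProperColouring (BlowUp (h * 2) (Complete (suc r))) (r * (h * 2))
evenMultipartite h r = subst (ProperColouring _) (colours≡ r h)
  (pullback split split-adjacent split-injective (blowUp h (CocktailParty.cocktailParty r)))
  where
  split : ℕ × ℕ → (ℕ × ℕ) × ℕ
  split (p , i) = (p , i / h) , i % h
  half<2 : ∀ {i} → i < h * 2 → i / h < 2
  half<2 {i} i<2h = m<n*o⇒m/o<n (subst (i <_) (*-comm h 2) i<2h)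
  split-adjacent : ∀ {u v} → BlowUp (h * 2) (Complete (suc r)) u v → BlowUp h (BlowUp 2 (Complete (suc r))) (split u) (split v)
  split-adjacent {p , i} {q , j} (pq , i< , j<) = (pq , half<2 i< , half<2 j<) , m%n<n i h , m%n<n j h
  split-injective : ∀ {u v w} → BlowUp (h * 2) (Complete (suc r)) u v → BlowUp (h * 2) (Complete (suc r)) u w →
                    split v ≡ split w → v ≡ w
  split-injective {v = q , j} {q′ , j′} _ _ eq =
    cong₂ _,_ (cong (proj₁ ∘ proj₁) eq) (divMod-injective (cong (proj₂ ∘ proj₁) eq) (cong proj₂ eq))
  colours≡ : ∀ r h → 2 * r * h ≡ r * (h * 2)
  colours≡ = solve-∀

-- By Euclid's lemma n is even or r is odd.
multipartiteColouring : ∀ n r .{{_ : NonZero n}} → 2 ∣ n * (r + 1) → ProperColouring (BlowUp n (Complete (suc r))) (r * n)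
multipartiteColouring n r 2∣n[r+1] with euclidsLemma n (r + 1) prime[2] 2∣n[r+1]
... | inj₁ (divides h refl)      = evenMultipartite h r {{m*n≢0⇒m≢0 h}}
... | inj₂ (divides zero r+1≡0)  = ⊥-elim (1+n≢0 (trans (+-comm 1 r) r+1≡0))
... | inj₂ (divides (suc k) r+1≡) =
  subst (λ r → ProperColouring (BlowUp n (Complete (suc r))) (r * n)) (sym r≡) (blowUp n (RoundRobin.roundRobin k))
  where
  r≡ : r ≡ suc (2 * k)
  r≡ = suc-injective (trans (+-comm 1 r) (trans r+1≡ (cong suc (cong suc (*-comm k 2)))))

idxOf : (sizes : List ℕ) → Fin (sum sizes) → ℕ
idxOf []       ()
idxOf (s ∷ ss) i with splitAt s i
... | inj₁ j = toℕ j
... | inj₂ j = idxOf ss j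

sizeAt : List ℕ → ℕ → ℕ
sizeAt []       _       = 0
sizeAt (s ∷ ss) zero    = s
sizeAt (s ∷ ss) (suc k) = sizeAt ss k

weightedSum : List ℕ → (ℕ → ℕ) → ℕ
weightedSum []       g = 0
weightedSum (s ∷ ss) g = s * g 0 + weightedSum ss (g ∘ suc)

module _ (s : ℕ) (ss : List ℕ) where

  partOf-↑ˡ : ∀ i → partOf (s ∷ ss) (i ↑ˡ sum ss) ≡ 0
  partOf-↑ˡ i rewrite splitAt-↑ˡ s i (sum ss) = refl

  idxOf-↑ˡ : ∀ i → idxOf (s ∷ ss) (i ↑ˡ sum ss) ≡ toℕ i
  idxOf-↑ˡ i rewrite splitAt-↑ˡ s i (sum ss) = refl

  partOf-↑ʳ : ∀ j → partOf (s ∷ ss) (s ↑ʳ j) ≡ suc (partOf ss j)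
  partOf-↑ʳ j rewrite splitAt-↑ʳ s (sum ss) j = refl

  idxOf-↑ʳ : ∀ j → idxOf (s ∷ ss) (s ↑ʳ j) ≡ idxOf ss j
  idxOf-↑ʳ j rewrite splitAt-↑ʳ s (sum ss) j = refl

  data SplitView : Fin (s + sum ss) → Set where
    first  : ∀ i → SplitView (i ↑ˡ sum ss)
    rest   : ∀ j → SplitView (s ↑ʳ j)

  splitView : ∀ u → SplitView u
  splitView u with splitAt s u in eq
  ... | inj₁ i = subst SplitView (splitAt⁻¹-↑ˡ eq) (first i)
  ... | inj₂ j = subst SplitView (splitAt⁻¹-↑ʳ eq) (rest j)

partOf-idxOf-injective : ∀ sizes {u w : Fin (sum sizes)} →
  partOf sizes u ≡ partOf sizes w → idxOf sizes u ≡ idxOf sizes w → u ≡ w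
partOf-idxOf-injective (s ∷ ss) {u} {w} p≡ i≡ with splitView s ss u | splitView s ss w
... | first i | first i′ = cong (_↑ˡ sum ss) (toℕ-injective (trans (sym (idxOf-↑ˡ s ss i)) (trans i≡ (idxOf-↑ˡ s ss i′))))
... | first i | rest j′  = ⊥-elim (0≢1+n (trans (sym (partOf-↑ˡ s ss i)) (trans p≡ (partOf-↑ʳ s ss j′))))
... | rest j  | first i′ = ⊥-elim (0≢1+n (trans (sym (partOf-↑ˡ s ss i′)) (trans (sym p≡) (partOf-↑ʳ s ss j))))
... | rest j  | rest j′  = cong (s ↑ʳ_) (partOf-idxOf-injective ss
  (suc-injective (trans (sym (partOf-↑ʳ s ss j)) (trans p≡ (partOf-↑ʳ s ss j′))))
  (trans (sym (idxOf-↑ʳ s ss j)) (trans i≡ (idxOf-↑ʳ s ss j′))))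

idxOf<sizeAt : ∀ sizes (u : Fin (sum sizes)) → idxOf sizes u < sizeAt sizes (partOf sizes u)
idxOf<sizeAt (s ∷ ss) u with splitView s ss u
... | first i rewrite partOf-↑ˡ s ss i | idxOf-↑ˡ s ss i = toℕ<n i
... | rest j  rewrite partOf-↑ʳ s ss j | idxOf-↑ʳ s ss j = idxOf<sizeAt ss j

partOf<length : ∀ sizes (u : Fin (sum sizes)) → partOf sizes u < length sizes
partOf<length (s ∷ ss) u with splitView s ss u
... | first i rewrite partOf-↑ˡ s ss i = s≤s z≤n
... | rest j  rewrite partOf-↑ʳ s ss j = s≤s (partOf<length ss j)

∑-partOf : ∀ sizes (g : ℕ → ℕ) → ∑ (λ u → g (partOf sizes u)) ≡ weightedSum sizes g
∑-partOf []       g = refl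
∑-partOf (s ∷ ss) g = begin
  ∑ (λ u → g (partOf (s ∷ ss) u))
    ≡⟨ ∑-↑ s (sum ss) _ ⟩
  ∑ (λ i → g (partOf (s ∷ ss) (i ↑ˡ sum ss))) + ∑ (λ j → g (partOf (s ∷ ss) (s ↑ʳ j)))
    ≡⟨ cong₂ _+_ (sum-cong-≗ (cong g ∘ partOf-↑ˡ s ss)) (sum-cong-≗ (cong g ∘ partOf-↑ʳ s ss)) ⟩
  ∑ {s} (λ _ → g 0) + ∑ (λ j → g (suc (partOf ss j)))
    ≡⟨ cong₂ _+_ (∑-const s (g 0)) (∑-partOf ss (g ∘ suc)) ⟩
  s * g 0 + weightedSum ss (g ∘ suc) ∎
  where open ≡-Reasoning

weightedSum-indicator : ∀ sizes p → weightedSum sizes (λ q → indicator (p ≡ᵇ q)) ≡ sizeAt sizes p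
weightedSum-indicator []       p       = refl
weightedSum-indicator (s ∷ ss) zero    = trans (cong₂ _+_ (*-identityʳ s) (weightedSum-zero ss)) (+-identityʳ s)
  where
  weightedSum-zero : ∀ ss → weightedSum ss (λ q → indicator (0 ≡ᵇ suc q)) ≡ 0
  weightedSum-zero []       = refl
  weightedSum-zero (s ∷ ss) = cong₂ _+_ (*-zeroʳ s) (weightedSum-zero ss)
weightedSum-indicator (s ∷ ss) (suc p) = cong₂ _+_ (*-zeroʳ s) (weightedSum-indicator ss p)

module _ (sizes : List ℕ) where

  private
    V : ℕ
    V = sum sizes
    adj : Fin V → Fin V → Bool
    adj = completeMultipartiteAdj sizes

  adj-sym : ∀ u w → adj u w ≡ adj w u
  adj-sym u w = cong not (does-cong (partOf sizes u ≟ partOf sizes w) (partOf sizes w ≟ partOf sizes u) (mk⇔ sym sym))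

  adj⇒≢ : ∀ {u w} → adj u w ≡ true → partOf sizes u ≢ partOf sizes w
  adj⇒≢ {u} {w} uw p≡ = case trans (sym (cong not (dec-true (partOf sizes u ≟ partOf sizes w) p≡))) uw of λ ()

  degree+sizeAt≡ : ∀ u → degree adj u + sizeAt sizes (partOf sizes u) ≡ V
  degree+sizeAt≡ u = begin
    degree adj u + sizeAt sizes p
      ≡⟨ cong₂ _+_ (count-tabulate (adj u) id) (sym (trans (∑-partOf sizes _) (weightedSum-indicator sizes p))) ⟩
    ∑ (λ w → indicator (adj u w)) + ∑ (λ w → indicator (p ≡ᵇ partOf sizes w))
      ≡⟨ ∑-distrib-+ (λ w → indicator (adj u w)) _ ⟨
    ∑ (λ w → indicator (not (p ≡ᵇ partOf sizes w)) + indicator (p ≡ᵇ partOf sizes w))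
      ≡⟨ sum-cong-≗ (λ w → indicator-not+indicator (p ≡ᵇ partOf sizes w)) ⟩
    ∑ {V} (λ _ → 1)
      ≡⟨ ∑-const V 1 ⟩
    V * 1
      ≡⟨ *-identityʳ V ⟩
    V ∎
    where
    open ≡-Reasoning
    p : ℕ
    p = partOf sizes u
    indicator-not+indicator : ∀ b → indicator (not b) + indicator b ≡ 1
    indicator-not+indicator true  = refl
    indicator-not+indicator false = refl

sizeAt-replicate-< : ∀ r {n ss p} → p < r → sizeAt (replicate r n ++ ss) p ≡ n
sizeAt-replicate-< (suc r) {p = zero}  _         = refl
sizeAt-replicate-< (suc r) {p = suc p} (s≤s p<r) = sizeAt-replicate-< r p<r

sizeAt-replicate-≡ : ∀ r {n s ss} → sizeAt (replicate r n ++ s ∷ ss) r ≡ s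
sizeAt-replicate-≡ zero    = refl
sizeAt-replicate-≡ (suc r) = sizeAt-replicate-≡ r

length-replicate-∷ʳ : ∀ r {n L : ℕ} → length (replicate r n ++ L ∷ []) ≡ suc r
length-replicate-∷ʳ zero    = refl
length-replicate-∷ʳ (suc r) = cong suc (length-replicate-∷ʳ r)

sum-replicate-∷ʳ : ∀ r {n L} → sum (replicate r n ++ L ∷ []) ≡ r * n + L
sum-replicate-∷ʳ zero    {L = L} = +-identityʳ L
sum-replicate-∷ʳ (suc r) {n}     = trans (cong (n +_) (sum-replicate-∷ʳ r)) (sym (+-assoc n _ _))

weightedSum-replicate-∷ʳ : ∀ r {n L} (g : ℕ → ℕ) c → (∀ {p} → p < r → g p ≡ c) →
                           weightedSum (replicate r n ++ L ∷ []) g ≡ r * (n * c) + L * g r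
weightedSum-replicate-∷ʳ zero    {L = L} g c _   = +-identityʳ (L * g 0)
weightedSum-replicate-∷ʳ (suc r) {n}     g c g≡c =
  trans (cong₂ _+_ (cong (n *_) (g≡c (s≤s z≤n)))
                   (weightedSum-replicate-∷ʳ r (λ p → g (suc p)) c (λ p<r → g≡c (s≤s p<r))))
        (sym (+-assoc (n * c) _ _))

-- The graph K_{n,…,n,(tr+1)n}

-- The colour of the edge from the a-th small vertex to the e-th extra vertex: the extra vertices are
-- grouped m at a time, group q uses the colours m + 1 + q m, …, m + q m + m, and within a group the
-- colours form a Latin square.
module _ (m : ℕ) .{{_ : NonZero m}} where

  extraColour : ℕ → ℕ → ℕ
  extraColour a e = suc m + (e / m) * m + (e + a) % m

  extraColour-lower : ∀ a e → suc m + (e / m) * m ≤ extraColour a e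
  extraColour-lower a e = m≤m+n _ _

  extraColour-upper : ∀ a e → extraColour a e < suc m + (e / m) * m + m
  extraColour-upper a e = +-monoʳ-< (suc m + (e / m) * m) (m%n<n (e + a) m)

  extraColour-< : ∀ {t} a e → e < t * m → extraColour a e < suc (suc t * m)
  extraColour-< {t} a e e<tm = begin-strict
    extraColour a e               <⟨ extraColour-upper a e ⟩
    suc m + (e / m) * m + m       ≡⟨ cong suc (trans (+-assoc m _ m) (cong (m +_) (+-comm ((e / m) * m) m))) ⟩
    suc (m + suc (e / m) * m)     ≤⟨ s≤s (+-monoʳ-≤ m (*-monoˡ-≤ m (m<n*o⇒m/o<n {n = t} e<tm))) ⟩
    suc (suc t * m)               ∎
    where open ≤-Reasoning

  private
    extraColour-parts : ∀ {a a′ e e′} → extraColour a e ≡ extraColour a′ e′ →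
                        e / m ≡ e′ / m × (e + a) % m ≡ (e′ + a′) % m
    extraColour-parts {a} {a′} {e} {e′} eq = divMod-unique (m%n<n (e + a) m) (m%n<n (e′ + a′) m)
      (+-cancelˡ-≡ (suc m) _ _ (trans (sym (+-assoc (suc m) _ _)) (trans eq (+-assoc (suc m) _ _))))

  extraColour-injectiveʳ : ∀ {a e e′} → extraColour a e ≡ extraColour a e′ → e ≡ e′
  extraColour-injectiveʳ {a} eq with extraColour-parts eq
  ... | q≡ , ρ≡ = divMod-injective q≡ (%-cancel-+ʳ a ρ≡)

  extraColour-injectiveˡ : ∀ {a a′ e} → a < m → a′ < m → extraColour a e ≡ extraColour a′ e → a ≡ a′
  extraColour-injectiveˡ {e = e} a<m a′<m eq with extraColour-parts eq
  ... | _ , ρ≡ = %-injective-< a<m a′<m (%-cancel-+ˡ e ρ≡)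

module Knt (n r t : ℕ) {{n≢0 : NonZero n}} {{r≢0 : NonZero r}} where

  sizes : List ℕ
  sizes = sizesKnt n r t

  V m L : ℕ
  V = sum sizes
  m = r * n
  L = (t * r + 1) * n

  adj : Fin V → Fin V → Bool
  adj = completeMultipartiteAdj sizes

  P I : Fin V → ℕ
  P = partOf sizes
  I = idxOf sizes

  instance
    m≢0 : NonZero m
    m≢0 = m*n≢0 r n

  position : Fin V → ℕ × ℕ
  position u = P u , I u

  P<1+r : ∀ u → P u < suc r
  P<1+r u = subst (P u <_) (length-replicate-∷ʳ r) (partOf<length sizes u)

  I<n : ∀ u → P u < r → I u < n
  I<n u p<r = subst (I u <_) (sizeAt-replicate-< r p<r) (idxOf<sizeAt sizes u)

  I<L : ∀ u → P u ≡ r → I u < L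
  I<L u p≡r = subst (I u <_) (trans (cong (sizeAt sizes) p≡r) (sizeAt-replicate-≡ r)) (idxOf<sizeAt sizes u)

  -- The small parts together with the first n vertices of the big part span K_{(r+1)×n}; the other
  -- t m vertices of the big part are extra.
  data Kind (u : Fin V) : Set where
    small      : P u < r → Kind u
    bigRegular : P u ≡ r → I u < n → Kind u
    extra      : P u ≡ r → n ≤ I u → Kind u

  kind : ∀ u → Kind u
  kind u with m≤n⇒m<n∨m≡n (s≤s⁻¹ (P<1+r u))
  ... | inj₁ p<r = small p<r
  ... | inj₂ p≡r with I u <? n
  ...   | yes i<n = bigRegular p≡r i<n
  ...   | no  i≮n = extra p≡r (≮⇒≥ i≮n)

  private
    degree+partSize : ∀ u → degree adj u + sizeAt sizes (P u) ≡ r * n + L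
    degree+partSize u = trans (degree+sizeAt≡ sizes u) (sum-replicate-∷ʳ r)

  degree-small : ∀ u → P u < r → degree adj u ≡ suc t * m
  degree-small u p<r = +-cancelʳ-≡ n _ _ (begin
    degree adj u + n               ≡⟨ cong (degree adj u +_) (sizeAt-replicate-< r p<r) ⟨
    degree adj u + sizeAt sizes (P u) ≡⟨ degree+partSize u ⟩
    r * n + L                      ≡⟨ arithmetic n r t ⟩
    suc t * m + n                  ∎)
    where
    open ≡-Reasoning
    arithmetic : ∀ n r t → r * n + (t * r + 1) * n ≡ suc t * (r * n) + n
    arithmetic = solve-∀

  degree-big : ∀ u → P u ≡ r → degree adj u ≡ m
  degree-big u p≡r = +-cancelʳ-≡ L _ _ (begin
    degree adj u + L                  ≡⟨ cong (degree adj u +_) (trans (cong (sizeAt sizes) p≡r) (sizeAt-replicate-≡ r)) ⟨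
    degree adj u + sizeAt sizes (P u) ≡⟨ degree+partSize u ⟩
    m + L                             ∎)
    where open ≡-Reasoning

  adj-irrefl : ∀ u → adj u u ≡ false
  adj-irrefl u = cong not (dec-true (P u ≟ P u) refl)

  blocks : ℕ → ℕ
  blocks p with p <? r
  ... | yes _ = suc t
  ... | no  _ = 1

  blocks-small : ∀ {p} → p < r → blocks p ≡ suc t
  blocks-small {p} p<r with p <? r
  ... | yes _  = refl
  ... | no p≮r = ⊥-elim (p≮r p<r)

  blocks-big : blocks r ≡ 1
  blocks-big with r <? r
  ... | yes r<r = ⊥-elim (<-irrefl refl r<r)
  ... | no  _   = refl

  degree≡blocks*m : ∀ u → degree adj u ≡ blocks (P u) * m
  degree≡blocks*m u with m≤n⇒m<n∨m≡n (s≤s⁻¹ (P<1+r u))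
  ... | inj₁ p<r = trans (degree-small u p<r) (cong (_* m) (sym (blocks-small p<r)))
  ... | inj₂ p≡r = trans (degree-big u p≡r) (sym (trans (cong (λ p → blocks p * m) p≡r) (trans (cong (_* m) blocks-big) (*-identityˡ m))))

  totalDef≡0⇒2∣n[r+1] : ∀ (α : ProperEdgeColoring V adj) → totalDef α ≡ 0 → 2 ∣ n * (r + 1)
  totalDef≡0⇒2∣n[r+1] α total≡0 = ∣m+n∣m⇒∣n (subst (2 ∣_) ∑blocks≡ even) (divides (n * r * t) refl)
    where
    even : 2 ∣ ∑ (blocks ∘ P)
    even = intervalColouring⇒even α (adj-sym sizes) adj-irrefl total≡0 m (blocks ∘ P) degree≡blocks*m
    ∑blocks≡ : ∑ (blocks ∘ P) ≡ n * r * t * 2 + n * (r + 1)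
    ∑blocks≡ = begin
      ∑ (blocks ∘ P)                  ≡⟨ ∑-partOf sizes blocks ⟩
      weightedSum sizes blocks        ≡⟨ weightedSum-replicate-∷ʳ r blocks (suc t) blocks-small ⟩
      r * (n * suc t) + L * blocks r  ≡⟨ cong (λ b → r * (n * suc t) + L * b) blocks-big ⟩
      r * (n * suc t) + L * 1         ≡⟨ arithmetic n r t ⟩
      n * r * t * 2 + n * (r + 1)     ∎
      where
      open ≡-Reasoning
      arithmetic : ∀ n r t → r * (n * suc t) + (t * r + 1) * n * 1 ≡ n * r * t * 2 + n * (r + 1)
      arithmetic = solve-∀

  smallIndex : Fin V → ℕ
  smallIndex u = P u * n + I u

  extraIndex : Fin V → ℕ
  extraIndex u = I u ∸ n

  smallIndex<m : ∀ u → P u < r → smallIndex u < m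
  smallIndex<m u p<r = *+<-bound p<r (I<n u p<r)

  extraIndex<tm : ∀ u → P u ≡ r → n ≤ I u → extraIndex u < t * m
  extraIndex<tm u p≡r n≤i = +-cancelʳ-< n _ _ (subst₂ _<_ (sym (m∸n+n≡m n≤i)) (L≡ n r t) (I<L u p≡r))
    where
    L≡ : ∀ n r t → (t * r + 1) * n ≡ t * (r * n) + n
    L≡ = solve-∀

  data Edge (u w : Fin V) : Set where
    regular   : BlowUp n (Complete (suc r)) (position u) (position w) → Edge u w
    toExtra   : P u < r → P w ≡ r → n ≤ I w → Edge u w
    fromExtra : P u ≡ r → n ≤ I u → P w < r → Edge u w

  edge : ∀ {u w} → adj u w ≡ true → Edge u w
  edge {u} {w} uw with kind u | kind w
  ... | small pu    | small pw       = regular ((P<1+r u , P<1+r w , adj⇒≢ sizes uw) , I<n u pu , I<n w pw)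
  ... | small pu    | bigRegular _ iw = regular ((P<1+r u , P<1+r w , adj⇒≢ sizes uw) , I<n u pu , iw)
  ... | small pu    | extra pw nw    = toExtra pu pw nw
  ... | bigRegular _ iu | small pw    = regular ((P<1+r u , P<1+r w , adj⇒≢ sizes uw) , iu , I<n w pw)
  ... | bigRegular pu _ | bigRegular pw _ = ⊥-elim (adj⇒≢ sizes uw (trans pu (sym pw)))
  ... | bigRegular pu _ | extra pw _      = ⊥-elim (adj⇒≢ sizes uw (trans pu (sym pw)))
  ... | extra pu nu | small pw       = fromExtra pu nu pw
  ... | extra pu _  | bigRegular pw _ = ⊥-elim (adj⇒≢ sizes uw (trans pu (sym pw)))
  ... | extra pu _  | extra pw _      = ⊥-elim (adj⇒≢ sizes uw (trans pu (sym pw)))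

  module Extension (C : ProperColouring (BlowUp n (Complete (suc r))) m) where

    edgeColour : Fin V → Fin V → ℕ
    edgeColour u w with I u <? n | I w <? n
    ... | yes _ | yes _ = suc (colour C (position u) (position w))
    ... | yes _ | no  _ = extraColour m (smallIndex u) (extraIndex w)
    ... | no  _ | yes _ = extraColour m (smallIndex w) (extraIndex u)
    ... | no  _ | no  _ = 0

    edgeColour-regular : ∀ {u w} → I u < n → I w < n → edgeColour u w ≡ suc (colour C (position u) (position w))
    edgeColour-regular {u} {w} iu iw with I u <? n | I w <? n
    ... | yes _   | yes _   = refl
    ... | no  iu≮ | _       = ⊥-elim (iu≮ iu)
    ... | yes _   | no  iw≮ = ⊥-elim (iw≮ iw)

    edgeColour-toExtra : ∀ {u w} → I u < n → n ≤ I w → edgeColour u w ≡ extraColour m (smallIndex u) (extraIndex w)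
    edgeColour-toExtra {u} {w} iu nw with I u <? n | I w <? n
    ... | yes _   | no  _  = refl
    ... | no  iu≮ | _      = ⊥-elim (iu≮ iu)
    ... | yes _   | yes iw = ⊥-elim (<⇒≱ iw nw)

    edgeColour-fromExtra : ∀ {u w} → n ≤ I u → I w < n → edgeColour u w ≡ extraColour m (smallIndex w) (extraIndex u)
    edgeColour-fromExtra {u} {w} nu iw with I u <? n | I w <? n
    ... | no  _  | yes _   = refl
    ... | yes iu | _       = ⊥-elim (<⇒≱ iu nu)
    ... | no  _  | no  iw≮ = ⊥-elim (iw≮ iw)

    position-injective : ∀ {w w′} → position w ≡ position w′ → w ≡ w′
    position-injective eq = partOf-idxOf-injective sizes (cong proj₁ eq) (cong proj₂ eq)

    extraColour-pos : ∀ a e → 1 ≤ extraColour m a e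
    extraColour-pos a e = ≤-trans (s≤s z≤n) (extraColour-lower m a e)

    regular<extra : ∀ {x y} → BlowUp n (Complete (suc r)) x y → ∀ a e → suc (colour C x y) < extraColour m a e
    regular<extra xy a e = ≤-trans (s≤s (colour< C xy)) (≤-trans (m≤m+n (suc m) _) (extraColour-lower m a e))

    edgeColour-symmetric : ∀ u w → adj u w ≡ true → edgeColour u w ≡ edgeColour w u
    edgeColour-symmetric u w uw with edge uw
    ... | regular b@(_ , iu , iw) = trans (edgeColour-regular iu iw) (trans (cong suc (colour-sym C b)) (sym (edgeColour-regular iw iu)))
    ... | toExtra pu _ nw         = trans (edgeColour-toExtra (I<n u pu) nw) (sym (edgeColour-fromExtra nw (I<n u pu)))
    ... | fromExtra _ nu pw       = trans (edgeColour-fromExtra nu (I<n w pw)) (sym (edgeColour-toExtra (I<n w pw) nu))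

    edgeColour-positive : ∀ u w → adj u w ≡ true → 1 ≤ edgeColour u w
    edgeColour-positive u w uw with edge uw
    ... | regular (_ , iu , iw) rewrite edgeColour-regular iu iw            = s≤s z≤n
    ... | toExtra pu _ nw       rewrite edgeColour-toExtra (I<n u pu) nw    = extraColour-pos _ _
    ... | fromExtra _ nu pw     rewrite edgeColour-fromExtra nu (I<n w pw)  = extraColour-pos _ _

    edgeColour-injective : ∀ {u w w′} → adj u w ≡ true → adj u w′ ≡ true →
                           edgeColour u w ≡ edgeColour u w′ → w ≡ w′
    edgeColour-injective {u} {w} {w′} uw uw′ eq with edge uw | edge uw′
    ... | regular b@(_ , iu , iw) | regular b′@(_ , _ , iw′) =
      position-injective (colour-inj C b b′
        (suc-injective (trans (sym (edgeColour-regular iu iw)) (trans eq (edgeColour-regular iu iw′)))))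
    ... | regular b@(_ , iu , iw) | toExtra _ _ nw′ =
      ⊥-elim (<⇒≢ (regular<extra b _ _) (trans (sym (edgeColour-regular iu iw)) (trans eq (edgeColour-toExtra iu nw′))))
    ... | toExtra _ _ nw | regular b′@(_ , iu , iw′) =
      ⊥-elim (<⇒≢ (regular<extra b′ _ _) (trans (sym (edgeColour-regular iu iw′)) (trans (sym eq) (edgeColour-toExtra iu nw))))
    ... | toExtra pu pw nw | toExtra _ pw′ nw′ =
      position-injective (cong₂ _,_ (trans pw (sym pw′)) (∸-cancelʳ-≡ nw nw′ (extraColour-injectiveʳ m
        (trans (sym (edgeColour-toExtra (I<n u pu) nw)) (trans eq (edgeColour-toExtra (I<n u pu) nw′))))))
    ... | fromExtra _ nu pw | fromExtra _ _ pw′ with divMod-unique (I<n w pw) (I<n w′ pw′)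
          (extraColour-injectiveˡ m (smallIndex<m w pw) (smallIndex<m w′ pw′)
            (trans (sym (edgeColour-fromExtra nu (I<n w pw))) (trans eq (edgeColour-fromExtra nu (I<n w′ pw′)))))
    ...   | p≡ , i≡ = position-injective (cong₂ _,_ p≡ i≡)
    edgeColour-injective _ _ _ | regular (_ , iu , _) | fromExtra _ nu _ = ⊥-elim (<⇒≱ iu nu)
    edgeColour-injective _ _ _ | fromExtra _ nu _ | regular (_ , iu , _) = ⊥-elim (<⇒≱ iu nu)
    edgeColour-injective _ _ _ | toExtra pu _ _ | fromExtra pu≡ _ _     = ⊥-elim (<⇒≢ pu pu≡)
    edgeColour-injective _ _ _ | fromExtra pu≡ _ _ | toExtra pu _ _     = ⊥-elim (<⇒≢ pu pu≡)

    windowStart : Fin V → ℕ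
    windowStart u with kind u
    ... | extra _ _ = suc m + (extraIndex u / m) * m
    ... | _         = 1

    edgeColour-window : ∀ u w → adj u w ≡ true → windowStart u ≤ edgeColour u w × edgeColour u w < windowStart u + degree adj u
    edgeColour-window u w uw with kind u | edge uw
    ... | small pu | regular b@(_ , iu , iw) rewrite degree-small u pu | edgeColour-regular iu iw =
      s≤s z≤n , s≤s (≤-trans (colour< C b) (m≤m+n m (t * m)))
    ... | small pu | toExtra _ pw nw rewrite degree-small u pu | edgeColour-toExtra (I<n u pu) nw =
      extraColour-pos _ _ , extraColour-< m {t} _ _ (extraIndex<tm w pw nw)
    ... | bigRegular pu iu | regular b@(_ , _ , iw) rewrite degree-big u pu | edgeColour-regular iu iw =
      s≤s z≤n , s≤s (colour< C b)
    ... | extra pu nu | fromExtra _ _ pw rewrite degree-big u pu | edgeColour-fromExtra nu (I<n w pw) =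
      extraColour-lower m _ _ , extraColour-upper m _ _
    ... | small pu         | fromExtra pu≡ _ _ = ⊥-elim (<⇒≢ pu pu≡)
    ... | bigRegular pu _  | toExtra pu< _ _   = ⊥-elim (<⇒≢ pu< pu)
    ... | bigRegular _ iu  | fromExtra _ nu _  = ⊥-elim (<⇒≱ iu nu)
    ... | extra _ nu       | regular (_ , iu , _) = ⊥-elim (<⇒≱ iu nu)
    ... | extra pu _       | toExtra pu< _ _   = ⊥-elim (<⇒≢ pu< pu)

    α : ProperEdgeColoring V adj
    α = record
      { col    = edgeColour
      ; sym    = edgeColour-symmetric
      ; pos    = edgeColour-positive
      ; proper = λ u w w′ uw uw′ w≢w′ eq → w≢w′ (edgeColour-injective uw uw′ eq)
      }

    totalDef[α]≡0 : totalDef α ≡ 0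
    totalDef[α]≡0 = Equivalence.from (totalDef≡0⇔ α)
      (λ u → neighbourWindow⇒defV≡0 α u (windowStart u) (edgeColour-window u))

theorem9 : (n r t : ℕ) → n ≥ 1 → r ≥ 1 → t ≥ 1 →
    IsDeficiency (sum (sizesKnt n r t)) (completeMultipartiteAdj (sizesKnt n r t)) 0
      ⇔ 2 ∣ n * (r + 1)
theorem9 n r t n≥1 r≥1 _ = mk⇔
  (λ ((α , total≡0) , _) → totalDef≡0⇒2∣n[r+1] α total≡0)
  (λ 2∣n[r+1] → let open Extension (multipartiteColouring n r 2∣n[r+1]) in (α , totalDef[α]≡0) , λ _ → z≤n)
  where
  instance
    n≢0 : NonZero n
    n≢0 = >-nonZero n≥1
    r≢0 : NonZero r
    r≢0 = >-nonZero r≥1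
  open Knt n r t
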